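{- Let $\mathcal{R}$ be a countably infinite metrically complete standard distance monoid and let $\mathbb{U}=\mathbb{U}_{\mathcal{R}}$. Then $\mathrm{IE}(\mathbb{U})$ is pinching: for every sufficiently small $\epsilon\in R\setminus\{0\}$ and every $a\in\mathbb{U}$ there are $\phi,\psi\in\mathrm{IE}(\mathbb{U})$ with $\phi\restriction(\mathbb{U}\setminus B_\epsilon(a))=\psi\restriction(\mathbb{U}\setminus B_\epsilon(a))$ and $\phi(b)\ne\psi(b)$ for all $b\in B_\epsilon(a)$.
   Context: A distance monoid $\mathcal{R}=(R,\le,\oplus,0)$ is a commutative monoid with total order such that $r\le r\oplus s$ and $s\le s'\Rightarrow s\oplus t\le s'\oplus t$. Metrically complete: for all $s\le r$ the set $\{t:r\le t\oplus s\}$ has a least element. Standard: whenever $0\ne r$ and $s<r$ there is $0\ne t$ with $s\oplus t<r$. An $\mathcal{R}$-metric space has $d:X^2\to R$ with $d(x,y)=0\iff x=y$, symmetry, and $d(x,z)\le d(x,y)\oplus d(y,z)$. $\mathbb{U}_{\mathcal{R}}$ is the unique (up to isometry) countable $\mathcal{R}$-metric space into which every finite $\mathcal{R}$-metric space embeds and in which every isometry between finite subspaces extends to a global isometry. $\mathrm{IE}(\mathbb{U})$ is the monoid of isometric self-embeddings; $B_\epsilon(a)=\{b:d(a,b)<\epsilon\}$. -}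

module Defs where

open import Data.Nat using (ℕ)
open import Data.Fin using (Fin)
open import Data.Product using (Σ; ∃; _×_; _,_)
open import Relation.Binary.PropositionalEquality using (_≡_; _≢_)
open import Relation.Binary.Structures using (IsTotalOrder)
open import Algebra.Structures using (IsCommutativeMonoid)
open import Relation.Nullary using (¬_)
open import Function.Bundles using (Bijection; Surjection)

record DistanceMonoid : Set₁ where
  infixl 6 _⊕_
  infix 4 _≤_
  field
    Carrier  : Set
    _≤_      : Carrier → Carrier → Set
    _⊕_      : Carrier → Carrier → Carrier
    0#       : Carrier
    isCommutativeMonoid : IsCommutativeMonoid _≡_ _⊕_ 0#
    isTotalOrder        : IsTotalOrder _≡_ _≤_
    ≤-⊕      : ∀ r s → r ≤ r ⊕ s
    ⊕-monoˡ  : ∀ s s′ t → s ≤ s′ → s ⊕ t ≤ s′ ⊕ t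

  infix 4 _<_
  _<_ : Carrier → Carrier → Set
  s < r = s ≤ r × s ≢ r

module _ (R : DistanceMonoid) where
  open DistanceMonoid R

  MetricallyComplete : Set
  MetricallyComplete = ∀ s r → s ≤ r →
    Σ Carrier λ t → (r ≤ t ⊕ s) × (∀ t′ → r ≤ t′ ⊕ s → t ≤ t′)

  Standard : Set
  Standard = ∀ r s → r ≢ 0# → s < r → Σ Carrier λ t → t ≢ 0# × s ⊕ t < r

  CountablyInfinite : Set
  CountablyInfinite = Bijection (Relation.Binary.PropositionalEquality.setoid ℕ)
                                (Relation.Binary.PropositionalEquality.setoid Carrier)

  record Metric (X : Set) : Set where
    field
      d        : X → X → Carrier
      d-zero⇒≡ : ∀ x y → d x y ≡ 0# → x ≡ y
      ≡⇒d-zero : ∀ x → d x x ≡ 0#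
      d-sym    : ∀ x y → d x y ≡ d y x
      d-tri    : ∀ x y z → d x z ≤ d x y ⊕ d y z

  open Metric

  IsIsometricEmbedding : {X Y : Set} → Metric X → Metric Y → (X → Y) → Set
  IsIsometricEmbedding {X} mX mY f = ∀ x y → d mY (f x) (f y) ≡ d mX x y

  IsIsometry : {X : Set} → Metric X → (X → X) → Set
  IsIsometry {X} m h = IsIsometricEmbedding m m h × (∀ y → Σ X λ x → h x ≡ y)

  record IsUrysohn (U : Set) (m : Metric U) : Set where
    field
      countable : Surjection (Relation.Binary.PropositionalEquality.setoid ℕ)
                             (Relation.Binary.PropositionalEquality.setoid U)
      universal : ∀ (n : ℕ) (F : Metric (Fin n)) →
                  Σ (Fin n → U) λ e → IsIsometricEmbedding F m e
      -- a finite subspace is listed by f : Fin n → U; a partial isometry sends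
      -- f i to g i and preserves distances
      homogeneous : ∀ (n : ℕ) (f g : Fin n → U) →
                    (∀ i j → d m (f i) (f j) ≡ d m (g i) (g j)) →
                    Σ (U → U) λ h → IsIsometry m h × (∀ i → h (f i) ≡ g i)

  Ball : {U : Set} → Metric U → Carrier → U → U → Set
  Ball m ε a b = d m a b < ε

{-# OPTIONS --safe #-}
-- Put t(x) = ε ∸ d(a,x), the least t with ε ≤ t ⊕ d(a,x); it exists by metric
-- completeness, is 1-Lipschitz, and vanishes exactly outside B_ε(a).  Glue two
-- copies of U, putting x in one copy and y in the other at distance
-- max(d(x,y), min(t x, t y)), so that the two copies of b are t(b) apart.  This
-- countable pseudometric space embeds isometrically into U one point at a time,
-- since every finite Katětov function over U is realised (by universality and
-- homogeneity).  The two copies of U give φ and ψ.  This works for every ε.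
module Submission where

open import Defs
open import Algebra.Structures using (IsCommutativeMonoid)
import Algebra.Construct.NaturalChoice.Min as Min
import Algebra.Construct.NaturalChoice.Max as Max
open import Data.Bool using (Bool; true; false)
open import Data.Empty using (⊥-elim)
open import Data.Fin using (Fin; zero; suc; toℕ; fromℕ<)
open import Data.Fin.Properties using (any?; toℕ<n; toℕ-fromℕ<)
open import Data.Nat as ℕ using (ℕ; zero; suc)
open import Data.Nat.Properties using (m<1+n⇒m<n∨m≡n; <-irrefl; m≤m+n; m≤n+m; 0≢1+n)
open import Data.Product using (Σ; _×_; _,_; proj₁; proj₂; map₁)
open import Data.Product.Function.NonDependent.Propositional using (_×-↠_)
open import Data.Sum using (inj₁; inj₂)
open import Function using (_∘_; const)
open import Function.Bundles using (Bijection; Surjection; _↠_; mk↠ₛ)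
open import Function.Construct.Composition using (_↠-∘_)
open import Function.Construct.Identity using (↠-id)
open import Function.Definitions using (Injective)
open import Relation.Binary.Bundles using (TotalOrder)
open import Relation.Binary.Definitions using (Decidable; DecidableEquality; Minimum)
open import Relation.Binary.PropositionalEquality
import Relation.Binary.Reasoning.PartialOrder as PartialOrderReasoning
open import Relation.Binary.Structures using (IsTotalOrder)
open import Relation.Nullary using (¬_; Dec; yes; no)
open import Relation.Nullary.Decidable using (map′)

module DistanceMonoidProperties (R : DistanceMonoid) where
  open DistanceMonoid R
  open IsCommutativeMonoid isCommutativeMonoid using (comm; identityˡ)
  open IsTotalOrder isTotalOrder public using ()
    renaming (antisym to ≤-antisym; total to ≤-total; reflexive to ≤-reflexive; trans to ≤-trans)

  totalOrder : TotalOrder _ _ _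
  totalOrder = record { isTotalOrder = isTotalOrder }

  module ≤-Reasoning = PartialOrderReasoning (TotalOrder.poset totalOrder)

  open Min totalOrder public using (_⊓_; ⊓-mono-≤; ⊓-idem; ⊓-comm; mono-≤-distrib-⊓)
  open Max totalOrder public using (_⊔_; ⊔-mono-≤; ⊔-identityˡ; x≤x⊔y; mono-≤-distrib-⊔)

  0#-minimum : Minimum _≤_ 0#
  0#-minimum r = subst (0# ≤_) (identityˡ r) (≤-⊕ 0# r)

  x≤y⊕x : ∀ x y → x ≤ y ⊕ x
  x≤y⊕x x y = subst (x ≤_) (comm x y) (≤-⊕ x y)

  ⊕-monoˡ-≤ : ∀ t {s s′} → s ≤ s′ → s ⊕ t ≤ s′ ⊕ t
  ⊕-monoˡ-≤ t {s} {s′} = ⊕-monoˡ s s′ t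

  ⊕-monoʳ-≤ : ∀ t {s s′} → s ≤ s′ → t ⊕ s ≤ t ⊕ s′
  ⊕-monoʳ-≤ t {s} {s′} s≤s′ = subst₂ _≤_ (comm s t) (comm s′ t) (⊕-monoˡ-≤ t s≤s′)

  ⊕-mono-≤ : ∀ {a a′ b b′} → a ≤ a′ → b ≤ b′ → a ⊕ b ≤ a′ ⊕ b′
  ⊕-mono-≤ {a′ = a′} {b} a≤a′ b≤b′ = ≤-trans (⊕-monoˡ-≤ b a≤a′) (⊕-monoʳ-≤ a′ b≤b′)

  ⊕-distribˡ-⊓ : ∀ c x y → c ⊕ (x ⊓ y) ≡ (c ⊕ x) ⊓ (c ⊕ y)
  ⊕-distribˡ-⊓ c = mono-≤-distrib-⊓ (cong (c ⊕_)) (⊕-monoʳ-≤ c)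

  ⊕-distribˡ-⊔ : ∀ c x y → c ⊕ (x ⊔ y) ≡ (c ⊕ x) ⊔ (c ⊕ y)
  ⊕-distribˡ-⊔ c = mono-≤-distrib-⊔ (cong (c ⊕_)) (⊕-monoʳ-≤ c)

  module _ (_≤?_ : Decidable _≤_) where

    ≡0? : ∀ r → Dec (r ≡ 0#)
    ≡0? r = map′ (λ r≤0 → ≤-antisym r≤0 (0#-minimum r)) ≤-reflexive (r ≤? 0#)

    ≮⇒≥ : ∀ {x y} → ¬ (x < y) → y ≤ x
    ≮⇒≥ {x} {y} x≮y with y ≤? x
    ... | yes y≤x = y≤x
    ... | no y≰x with ≤-total x y
    ...   | inj₁ x≤y = ⊥-elim (x≮y (x≤y , λ x≡y → y≰x (≤-reflexive (sym x≡y))))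
    ...   | inj₂ y≤x = y≤x

    nonzero-element : CountablyInfinite R → Σ Carrier (_≢ 0#)
    nonzero-element ℕ⤖Carrier = choose (≡0? (to 0))
      where
      open Bijection ℕ⤖Carrier
      choose : Dec (to 0 ≡ 0#) → Σ Carrier (_≢ 0#)
      choose (no to0≢0)  = to 0 , to0≢0
      choose (yes to0≡0) = to 1 , λ to1≡0 → 0≢1+n (injective (trans to0≡0 (sym to1≡0)))

module KatetovFunctions (R : DistanceMonoid) where
  open DistanceMonoid R
  open DistanceMonoidProperties R
  open IsCommutativeMonoid isCommutativeMonoid using (comm; identityˡ; identityʳ)

  record IsPseudometric {X : Set} (δ : X → X → Carrier) : Set where
    field
      diagonal  : ∀ x → δ x x ≡ 0#
      symmetric : ∀ x y → δ x y ≡ δ y x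
      triangle  : ∀ x y z → δ x z ≤ δ x y ⊕ δ y z

  pseudometric-∘ : ∀ {X Y : Set} {δ : X → X → Carrier} (g : Y → X) →
                   IsPseudometric δ → IsPseudometric (λ y y′ → δ (g y) (g y′))
  pseudometric-∘ g δ-pseudo = record
    { diagonal  = λ y → diagonal (g y)
    ; symmetric = λ y y′ → symmetric (g y) (g y′)
    ; triangle  = λ y y′ y″ → triangle (g y) (g y′) (g y″)
    }
    where open IsPseudometric δ-pseudo

  IsLipschitz : ∀ {X : Set} → Metric R X → (X → Carrier) → Set
  IsLipschitz m t = ∀ x y → t x ≤ t y ⊕ Metric.d m x y

  record IsKatetov {I : Set} (δ : I → I → Carrier) (r : I → Carrier) : Set where
    field
      δ≤r⊕r : ∀ i j → δ i j ≤ r i ⊕ r j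
      r≤δ⊕r : ∀ i j → r i ≤ δ i j ⊕ r j

  katetov-∘ : ∀ {I J : Set} {δ : I → I → Carrier} {r : I → Carrier} (g : J → I) →
              IsKatetov δ r → IsKatetov (λ j j′ → δ (g j) (g j′)) (r ∘ g)
  katetov-∘ g K = record
    { δ≤r⊕r = λ j j′ → δ≤r⊕r (g j) (g j′)
    ; r≤δ⊕r = λ j j′ → r≤δ⊕r (g j) (g j′)
    }
    where open IsKatetov K

  katetov-cong : ∀ {I : Set} {δ δ′ : I → I → Carrier} {r : I → Carrier} →
                 (∀ i j → δ i j ≡ δ′ i j) → IsKatetov δ r → IsKatetov δ′ r
  katetov-cong {r = r} δ≡δ′ K = record
    { δ≤r⊕r = λ i j → subst (_≤ r i ⊕ r j) (δ≡δ′ i j) (δ≤r⊕r i j)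
    ; r≤δ⊕r = λ i j → subst (λ e → r i ≤ e ⊕ r j) (δ≡δ′ i j) (r≤δ⊕r i j)
    }
    where open IsKatetov K

  pseudometric-katetov : ∀ {X : Set} {δ : X → X → Carrier} →
                         IsPseudometric δ → ∀ x → IsKatetov δ (δ x)
  pseudometric-katetov {δ = δ} δ-pseudo x = record
    { δ≤r⊕r = λ i j → subst (λ e → δ i j ≤ e ⊕ δ x j) (symmetric i x) (triangle i x j)
    ; r≤δ⊕r = λ i j → subst (δ x i ≤_) (trans (comm _ _) (cong (_⊕ δ x j) (symmetric j i)))
                                          (triangle x j i)
    }
    where open IsPseudometric δ-pseudo

  module _ {I : Set} {δ : I → I → Carrier} {r : I → Carrier}
           (δ-sym : ∀ i j → δ i j ≡ δ j i) (K : IsKatetov δ r) where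
    open IsKatetov K

    katetov-zero : ∀ {i} → r i ≡ 0# → ∀ j → δ i j ≡ r j
    katetov-zero {i} rᵢ≡0 j = ≤-antisym
      (subst (δ i j ≤_) (trans (cong (_⊕ r j) rᵢ≡0) (identityˡ (r j))) (δ≤r⊕r i j))
      (subst (r j ≤_) (trans (cong₂ _⊕_ (δ-sym j i) rᵢ≡0) (identityʳ (δ i j))) (r≤δ⊕r j i))

    katetov-resp : ∀ {i j} → δ i j ≡ 0# → r i ≡ r j
    katetov-resp {i} {j} δᵢⱼ≡0 = ≤-antisym (bound i j δᵢⱼ≡0) (bound j i (trans (δ-sym j i) δᵢⱼ≡0))
      where
      bound : ∀ i j → δ i j ≡ 0# → r i ≤ r j
      bound i j δᵢⱼ≡0 = subst (r i ≤_) (trans (cong (_⊕ r j) δᵢⱼ≡0) (identityˡ (r j))) (r≤δ⊕r i j)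

record Deduplication {A : Set} {n : ℕ} (f : Fin n → A) : Set where
  field
    size             : ℕ
    points           : Fin size → A
    points-injective : Injective _≡_ _≡_ points
    index            : Fin n → Fin size
    points∘index     : ∀ i → points (index i) ≡ f i
    origin           : Fin size → Fin n
    f∘origin         : ∀ j → f (origin j) ≡ points j

module _ {A : Set} {n : ℕ} {f : Fin (suc n) → A} (D : Deduplication (f ∘ suc)) where
  open Deduplication D

  dropHead : ∀ j → points j ≡ f zero → Deduplication f
  dropHead j pⱼ≡f₀ = record
    { size = size ; points = points ; points-injective = points-injective
    ; index = index′ ; points∘index = points∘index′
    ; origin = suc ∘ origin ; f∘origin = f∘origin
    }
    where
    index′ : Fin (suc n) → Fin size
    index′ zero    = j
    index′ (suc i) = index i
    points∘index′ : ∀ i → points (index′ i) ≡ f i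
    points∘index′ zero    = pⱼ≡f₀
    points∘index′ (suc i) = points∘index i

  keepHead : (∀ j → points j ≢ f zero) → Deduplication f
  keepHead fresh = record
    { size = suc size ; points = points′ ; points-injective = points′-injective
    ; index = index′ ; points∘index = points∘index′
    ; origin = origin′ ; f∘origin = f∘origin′
    }
    where
    points′ : Fin (suc size) → A
    points′ zero    = f zero
    points′ (suc j) = points j
    points′-injective : Injective _≡_ _≡_ points′
    points′-injective {zero}  {zero}  _ = refl
    points′-injective {zero}  {suc j} e = ⊥-elim (fresh j (sym e))
    points′-injective {suc i} {zero}  e = ⊥-elim (fresh i e)
    points′-injective {suc i} {suc j} e = cong suc (points-injective e)
    index′ : Fin (suc n) → Fin (suc size)
    index′ zero    = zero
    index′ (suc i) = suc (index i)
    points∘index′ : ∀ i → points′ (index′ i) ≡ f i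
    points∘index′ zero    = refl
    points∘index′ (suc i) = points∘index i
    origin′ : Fin (suc size) → Fin (suc n)
    origin′ zero    = zero
    origin′ (suc j) = suc (origin j)
    f∘origin′ : ∀ j → f (origin′ j) ≡ points′ j
    f∘origin′ zero    = refl
    f∘origin′ (suc j) = f∘origin j

deduplicate : ∀ {A : Set} → DecidableEquality A → ∀ {n} (f : Fin n → A) → Deduplication f
deduplicate _ {zero} f = record
  { size = 0 ; points = λ () ; points-injective = λ { {()} }
  ; index = λ () ; points∘index = λ () ; origin = λ () ; f∘origin = λ ()
  }
deduplicate _≟_ {suc n} f with any? (λ j → points j ≟ f zero)
  where open Deduplication (deduplicate _≟_ (f ∘ suc))
... | yes (j , pⱼ≡f₀) = dropHead (deduplicate _≟_ (f ∘ suc)) j pⱼ≡f₀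
... | no ¬seen        = keepHead (deduplicate _≟_ (f ∘ suc)) (λ j pⱼ≡f₀ → ¬seen (j , pⱼ≡f₀))

module FiniteMetricSpaces (R : DistanceMonoid) where
  open DistanceMonoid R
  open DistanceMonoidProperties R
  open KatetovFunctions R
  open IsCommutativeMonoid isCommutativeMonoid using (comm)

  induced : ∀ {I X : Set} → Metric R X → (g : I → X) → Injective _≡_ _≡_ g → Metric R I
  induced m g g-injective = record
    { d        = λ i j → d (g i) (g j)
    ; d-zero⇒≡ = λ i j dᵢⱼ≡0 → g-injective (d-zero⇒≡ (g i) (g j) dᵢⱼ≡0)
    ; ≡⇒d-zero = λ i → ≡⇒d-zero (g i)
    ; d-sym    = λ i j → d-sym (g i) (g j)
    ; d-tri    = λ i j k → d-tri (g i) (g j) (g k)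
    }
    where open Metric m

  oneExtension : ∀ {k} (M : Metric R (Fin k)) (r : Fin k → Carrier) →
                 IsKatetov (Metric.d M) r → (∀ j → r j ≢ 0#) → Metric R (Fin (suc k))
  oneExtension {k} M r K r≢0 = record
    { d = δ ; d-zero⇒≡ = δ-zero⇒≡ ; ≡⇒d-zero = ≡⇒δ-zero ; d-sym = δ-sym ; d-tri = δ-tri }
    where
    open Metric M
    open IsKatetov K

    δ : Fin (suc k) → Fin (suc k) → Carrier
    δ zero    zero    = 0#
    δ zero    (suc j) = r j
    δ (suc i) zero    = r i
    δ (suc i) (suc j) = d i j

    δ-zero⇒≡ : ∀ x y → δ x y ≡ 0# → x ≡ y
    δ-zero⇒≡ zero    zero    _ = refl
    δ-zero⇒≡ zero    (suc j) e = ⊥-elim (r≢0 j e)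
    δ-zero⇒≡ (suc i) zero    e = ⊥-elim (r≢0 i e)
    δ-zero⇒≡ (suc i) (suc j) e = cong suc (d-zero⇒≡ i j e)

    ≡⇒δ-zero : ∀ x → δ x x ≡ 0#
    ≡⇒δ-zero zero    = refl
    ≡⇒δ-zero (suc i) = ≡⇒d-zero i

    δ-sym : ∀ x y → δ x y ≡ δ y x
    δ-sym zero    zero    = refl
    δ-sym zero    (suc j) = refl
    δ-sym (suc i) zero    = refl
    δ-sym (suc i) (suc j) = d-sym i j

    δ-tri : ∀ x y z → δ x z ≤ δ x y ⊕ δ y z
    δ-tri zero    zero    zero    = 0#-minimum _
    δ-tri zero    zero    (suc j) = x≤y⊕x (r j) 0#
    δ-tri zero    (suc i) zero    = 0#-minimum _
    δ-tri zero    (suc i) (suc j) =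
      subst (r j ≤_) (trans (comm _ _) (cong (r i ⊕_) (d-sym j i))) (r≤δ⊕r j i)
    δ-tri (suc i) zero    zero    = ≤-⊕ (r i) 0#
    δ-tri (suc i) zero    (suc j) = δ≤r⊕r i j
    δ-tri (suc i) (suc j) zero    = r≤δ⊕r i j
    δ-tri (suc i) (suc j) (suc l) = d-tri i j l

module UrysohnProperties (R : DistanceMonoid) (_≤?_ : Decidable (DistanceMonoid._≤_ R))
                         {U : Set} (m : Metric R U) (isUrysohn : IsUrysohn R U m) where
  open DistanceMonoid R
  open DistanceMonoidProperties R
  open KatetovFunctions R
  open FiniteMetricSpaces R
  open Metric m
  open IsUrysohn isUrysohn

  ≡⇒d≡0 : ∀ {x y} → x ≡ y → d x y ≡ 0#
  ≡⇒d≡0 {x} refl = ≡⇒d-zero x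

  _≟U_ : DecidableEquality U
  x ≟U y = map′ (d-zero⇒≡ x y) ≡⇒d≡0 (≡0? _≤?_ (d x y))

  Isometric : ∀ {X : Set} → (X → X → Carrier) → (X → U) → Set
  Isometric δ e = ∀ x y → d (e x) (e y) ≡ δ x y

  Realises : ∀ {n} → (Fin n → U) → (Fin n → Carrier) → U → Set
  Realises f r u = ∀ i → d u (f i) ≡ r i

  katetov-realised-≢0 : ∀ {n} (f : Fin n → U) (r : Fin n → Carrier) →
                        IsKatetov (λ i j → d (f i) (f j)) r → (∀ i → r i ≢ 0#) →
                        Σ U (Realises f r)
  katetov-realised-≢0 f r K r≢0 = realise (universal (suc size) M)
    where
    -- Universality needs a genuine metric, so r is realised abstractly over the
    -- distinct points and that copy is then moved onto them by homogeneity.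
    open Deduplication (deduplicate _≟U_ f)
    K′ : IsKatetov (λ i j → d (points i) (points j)) (r ∘ origin)
    K′ = katetov-cong (λ i j → cong₂ d (f∘origin i) (f∘origin j)) (katetov-∘ origin K)
    M : Metric R (Fin (suc size))
    M = oneExtension (induced m points points-injective) (r ∘ origin) K′ (r≢0 ∘ origin)
    realise : Σ (Fin (suc size) → U) (IsIsometricEmbedding R M m) → Σ U (Realises f r)
    realise (e , e-isometric) =
      moveOntoPoints (homogeneous size (e ∘ suc) points (λ i j → e-isometric (suc i) (suc j)))
      where
      moveOntoPoints : Σ (U → U) (λ h → IsIsometry R m h × (∀ i → h (e (suc i)) ≡ points i)) →
                       Σ U (Realises f r)
      moveOntoPoints (h , (h-isometric , _) , h∘e∘suc) = h (e zero) , realises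
        where
        realises : Realises f r (h (e zero))
        realises i = begin
          d (h (e zero)) (f i)                   ≡⟨ cong (d (h (e zero))) (sym (points∘index i)) ⟩
          d (h (e zero)) (points (index i))      ≡⟨ cong (d (h (e zero))) (sym (h∘e∘suc (index i))) ⟩
          d (h (e zero)) (h (e (suc (index i)))) ≡⟨ h-isometric _ _ ⟩
          d (e zero) (e (suc (index i)))         ≡⟨ e-isometric _ _ ⟩
          r (origin (index i))                   ≡⟨ katetov-resp (λ i j → d-sym (f i) (f j)) K
                                                      (≡⇒d≡0 (trans (f∘origin (index i)) (points∘index i))) ⟩
          r i                                    ∎
          where open ≡-Reasoning

  katetov-realised : ∀ {n} (f : Fin n → U) (r : Fin n → Carrier) →
                     IsKatetov (λ i j → d (f i) (f j)) r → Σ U (Realises f r)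
  katetov-realised f r K with any? (λ i → ≡0? _≤?_ (r i))
  ... | yes (i , rᵢ≡0) = f i , katetov-zero (λ i j → d-sym (f i) (f j)) K rᵢ≡0
  ... | no ¬zero       = katetov-realised-≢0 f r K (λ i rᵢ≡0 → ¬zero (i , rᵢ≡0))

  module _ (D : ℕ → ℕ → Carrier) (D-pseudometric : IsPseudometric D) where
    open IsPseudometric D-pseudometric

    AgreesBelow : ℕ → (ℕ → U) → Set
    AgreesBelow n p = ∀ i j → i ℕ.< n → j ℕ.< n → d (p i) (p j) ≡ D i j

    setFrom : ℕ → U → (ℕ → U) → ℕ → U
    setFrom n u p k with k ℕ.<? n
    ... | yes _ = p k
    ... | no _  = u

    setFrom-< : ∀ {n u p k} → k ℕ.< n → setFrom n u p k ≡ p k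
    setFrom-< {n} {k = k} k<n with k ℕ.<? n
    ... | yes _  = refl
    ... | no k≮n = ⊥-elim (k≮n k<n)

    setFrom-≡ : ∀ n {u p} → setFrom n u p n ≡ u
    setFrom-≡ n with n ℕ.<? n
    ... | yes n<n = ⊥-elim (<-irrefl refl n<n)
    ... | no _    = refl

    approximation : ∀ n → Σ (ℕ → U) (AgreesBelow n)
    approximation zero    = const (Surjection.to countable 0) , λ _ _ ()
    approximation (suc n) = setFrom n u p , agrees
      where
      p : ℕ → U
      p = proj₁ (approximation n)
      p-agrees : AgreesBelow n p
      p-agrees = proj₂ (approximation n)
      K : IsKatetov (λ i j → d (p (toℕ i)) (p (toℕ j))) (D n ∘ toℕ)
      K = katetov-cong (λ i j → sym (p-agrees _ _ (toℕ<n i) (toℕ<n j)))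
                       (katetov-∘ toℕ (pseudometric-katetov D-pseudometric n))
      realisation : Σ U (Realises (p ∘ toℕ) (D n ∘ toℕ))
      realisation = katetov-realised (p ∘ toℕ) (D n ∘ toℕ) K
      u : U
      u = proj₁ realisation
      d-u-p : ∀ {i} → i ℕ.< n → d u (p i) ≡ D n i
      d-u-p i<n = subst (λ k → d u (p k) ≡ D n k) (toℕ-fromℕ< i<n) (proj₂ realisation (fromℕ< i<n))
      agrees : AgreesBelow (suc n) (setFrom n u p)
      agrees i j i<1+n j<1+n with m<1+n⇒m<n∨m≡n i<1+n | m<1+n⇒m<n∨m≡n j<1+n
      ... | inj₁ i<n  | inj₁ j<n  = trans (cong₂ d (setFrom-< i<n) (setFrom-< j<n)) (p-agrees i j i<n j<n)
      ... | inj₁ i<n  | inj₂ refl = trans (cong₂ d (setFrom-< i<n) (setFrom-≡ n))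
                                          (trans (d-sym _ _) (trans (d-u-p i<n) (symmetric n i)))
      ... | inj₂ refl | inj₁ j<n  = trans (cong₂ d (setFrom-≡ n) (setFrom-< j<n)) (d-u-p j<n)
      ... | inj₂ refl | inj₂ refl = trans (≡⇒d≡0 refl) (sym (diagonal n))

    embedding : ℕ → U
    embedding k = proj₁ (approximation (suc k)) k

    approximation-stable : ∀ {n k} → k ℕ.< n → proj₁ (approximation n) k ≡ embedding k
    approximation-stable {suc n} k<1+n with m<1+n⇒m<n∨m≡n k<1+n
    ... | inj₁ k<n  = trans (setFrom-< k<n) (approximation-stable k<n)
    ... | inj₂ refl = refl

    embedding-isometric : Isometric D embedding
    embedding-isometric i j =
      trans (sym (cong₂ d (approximation-stable i<N) (approximation-stable j<N)))
            (proj₂ (approximation N) i j i<N j<N)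
      where
      N : ℕ
      N = suc (i ℕ.+ j)
      i<N : i ℕ.< N
      i<N = ℕ.s≤s (m≤m+n i j)
      j<N : j ℕ.< N
      j<N = ℕ.s≤s (m≤n+m j i)

  embed-countable : ∀ {X : Set} → ℕ ↠ X → (δ : X → X → Carrier) → IsPseudometric δ →
                    Σ (X → U) (Isometric δ)
  embed-countable s δ δ-pseudometric = embedding D D-pseudometric ∘ to⁻ , isometric
    where
    open Surjection s
    D : ℕ → ℕ → Carrier
    D i j = δ (to i) (to j)
    D-pseudometric : IsPseudometric D
    D-pseudometric = pseudometric-∘ to δ-pseudometric
    isometric : Isometric δ (embedding D D-pseudometric ∘ to⁻)
    isometric x y = trans (embedding-isometric D D-pseudometric _ _) (cong₂ δ (to∘to⁻ x) (to∘to⁻ y))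

module Monus (R : DistanceMonoid) (metricallyComplete : MetricallyComplete R) where
  open DistanceMonoid R
  open DistanceMonoidProperties R
  open IsCommutativeMonoid isCommutativeMonoid using (comm; assoc; identityˡ)

  -- Metric completeness gives the least t with r ≤ t ⊕ s only for s ≤ r;
  -- otherwise that least t is 0#.
  infixl 6 _∸_
  _∸_ : Carrier → Carrier → Carrier
  r ∸ s with ≤-total s r
  ... | inj₁ s≤r = proj₁ (metricallyComplete s r s≤r)
  ... | inj₂ _   = 0#

  r≤r∸s⊕s : ∀ r s → r ≤ (r ∸ s) ⊕ s
  r≤r∸s⊕s r s with ≤-total s r
  ... | inj₁ s≤r = proj₁ (proj₂ (metricallyComplete s r s≤r))
  ... | inj₂ r≤s = subst (r ≤_) (sym (identityˡ s)) r≤s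

  ∸-least : ∀ {r s t} → r ≤ t ⊕ s → r ∸ s ≤ t
  ∸-least {r} {s} {t} r≤t⊕s with ≤-total s r
  ... | inj₁ s≤r = proj₂ (proj₂ (metricallyComplete s r s≤r)) t r≤t⊕s
  ... | inj₂ _   = 0#-minimum t

  r≤s⇒r∸s≡0 : ∀ {r s} → r ≤ s → r ∸ s ≡ 0#
  r≤s⇒r∸s≡0 {r} {s} r≤s =
    ≤-antisym (∸-least (subst (r ≤_) (sym (identityˡ s)) r≤s)) (0#-minimum (r ∸ s))

  s<r⇒r∸s≢0 : ∀ {r s} → s < r → r ∸ s ≢ 0#
  s<r⇒r∸s≢0 {r} {s} (s≤r , s≢r) r∸s≡0 = s≢r (≤-antisym s≤r r≤s)
    where
    r≤s : r ≤ s
    r≤s = subst (r ≤_) (trans (cong (_⊕ s) r∸s≡0) (identityˡ s)) (r≤r∸s⊕s r s)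

  ∸-lipschitzʳ : ∀ {r s s′ e} → s′ ≤ s ⊕ e → r ∸ s ≤ (r ∸ s′) ⊕ e
  ∸-lipschitzʳ {r} {s} {s′} {e} s′≤s⊕e = ∸-least (begin
    r                  ≤⟨ r≤r∸s⊕s r s′ ⟩
    (r ∸ s′) ⊕ s′      ≤⟨ ⊕-monoʳ-≤ (r ∸ s′) s′≤s⊕e ⟩
    (r ∸ s′) ⊕ (s ⊕ e) ≡⟨ cong ((r ∸ s′) ⊕_) (comm s e) ⟩
    (r ∸ s′) ⊕ (e ⊕ s) ≡⟨ assoc (r ∸ s′) e s ⟨
    (r ∸ s′) ⊕ e ⊕ s   ∎)
    where open ≤-Reasoning

module Doubling (R : DistanceMonoid) {X : Set} (m : Metric R X) (t : X → DistanceMonoid.Carrier R)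
                (t-lipschitz : KatetovFunctions.IsLipschitz R m t) where
  open DistanceMonoid R
  open DistanceMonoidProperties R
  open KatetovFunctions R
  open Metric m
  open IsCommutativeMonoid isCommutativeMonoid using (comm)

  cross : X → X → Carrier
  cross x y = d x y ⊔ (t x ⊓ t y)

  cross-sym : ∀ x y → cross x y ≡ cross y x
  cross-sym x y = cong₂ _⊔_ (d-sym x y) (⊓-comm (t x) (t y))

  cross-diagonal : ∀ x → cross x x ≡ t x
  cross-diagonal x = trans (cong₂ _⊔_ (≡⇒d-zero x) (⊓-idem (t x))) (⊔-identityˡ 0#-minimum (t x))

  ⊓-lipschitz : ∀ x y z → t x ⊓ t z ≤ d x y ⊕ (t y ⊓ t z)
  ⊓-lipschitz x y z = begin
    t x ⊓ t z                         ≤⟨ ⊓-mono-≤ (subst (t x ≤_) (comm _ _) (t-lipschitz x y))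
                                                  (x≤y⊕x (t z) (d x y)) ⟩
    (d x y ⊕ t y) ⊓ (d x y ⊕ t z)     ≡⟨ ⊕-distribˡ-⊓ (d x y) (t y) (t z) ⟨
    d x y ⊕ (t y ⊓ t z)               ∎
    where open ≤-Reasoning

  cross-triangleˡ : ∀ x y z → cross x z ≤ d x y ⊕ cross y z
  cross-triangleˡ x y z = begin
    d x z ⊔ (t x ⊓ t z)                       ≤⟨ ⊔-mono-≤ (d-tri x y z) (⊓-lipschitz x y z) ⟩
    (d x y ⊕ d y z) ⊔ (d x y ⊕ (t y ⊓ t z))   ≡⟨ ⊕-distribˡ-⊔ (d x y) (d y z) (t y ⊓ t z) ⟨
    d x y ⊕ cross y z                         ∎
    where open ≤-Reasoning

  cross-triangleʳ : ∀ x y z → cross x z ≤ cross x y ⊕ d y z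
  cross-triangleʳ x y z = subst₂ _≤_ (cross-sym z x)
    (trans (comm _ _) (cong₂ _⊕_ (cross-sym y x) (d-sym z y))) (cross-triangleˡ z y x)

  d≤cross⊕cross : ∀ x y z → d x z ≤ cross x y ⊕ cross y z
  d≤cross⊕cross x y z = ≤-trans (d-tri x y z) (⊕-mono-≤ (x≤x⊔y _ _) (x≤x⊔y _ _))

  doubled : X × Bool → X × Bool → Carrier
  doubled (x , false) (y , false) = d x y
  doubled (x , true)  (y , true)  = d x y
  doubled (x , false) (y , true)  = cross x y
  doubled (x , true)  (y , false) = cross x y

  doubled-isPseudometric : IsPseudometric doubled
  doubled-isPseudometric = record { diagonal = diagonal ; symmetric = symmetric ; triangle = triangle }
    where
    diagonal : ∀ p → doubled p p ≡ 0#
    diagonal (x , false) = ≡⇒d-zero x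
    diagonal (x , true)  = ≡⇒d-zero x

    symmetric : ∀ p q → doubled p q ≡ doubled q p
    symmetric (x , false) (y , false) = d-sym x y
    symmetric (x , false) (y , true)  = cross-sym x y
    symmetric (x , true)  (y , false) = cross-sym x y
    symmetric (x , true)  (y , true)  = d-sym x y

    triangle : ∀ p q r → doubled p r ≤ doubled p q ⊕ doubled q r
    triangle (x , false) (y , false) (z , false) = d-tri x y z
    triangle (x , false) (y , false) (z , true)  = cross-triangleˡ x y z
    triangle (x , false) (y , true)  (z , false) = d≤cross⊕cross x y z
    triangle (x , false) (y , true)  (z , true)  = cross-triangleʳ x y z
    triangle (x , true)  (y , false) (z , false) = cross-triangleʳ x y z
    triangle (x , true)  (y , false) (z , true)  = d≤cross⊕cross x y z
    triangle (x , true)  (y , true)  (z , false) = cross-triangleˡ x y z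
    triangle (x , true)  (y , true)  (z , true)  = d-tri x y z

unpair : ℕ → ℕ × Bool
unpair zero          = 0 , false
unpair (suc zero)    = 0 , true
unpair (suc (suc k)) = map₁ suc (unpair k)

pair : ℕ × Bool → ℕ
pair (zero  , false) = 0
pair (zero  , true)  = 1
pair (suc n , b)     = suc (suc (pair (n , b)))

unpair∘pair : ∀ p → unpair (pair p) ≡ p
unpair∘pair (zero  , false) = refl
unpair∘pair (zero  , true)  = refl
unpair∘pair (suc n , b)     = cong (map₁ suc) (unpair∘pair (n , b))

ℕ↠ℕ×Bool : ℕ ↠ (ℕ × Bool)
ℕ↠ℕ×Bool = mk↠ₛ {to = unpair} (λ p → pair p , unpair∘pair p)

module Pinching (R : DistanceMonoid) (metricallyComplete : MetricallyComplete R)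
                (_≤?_ : Decidable (DistanceMonoid._≤_ R))
                {U : Set} (m : Metric R U) (isUrysohn : IsUrysohn R U m) where
  open DistanceMonoid R
  open DistanceMonoidProperties R
  open Monus R metricallyComplete
  open KatetovFunctions R using (IsLipschitz)
  open UrysohnProperties R _≤?_ m isUrysohn
  open Metric m
  open IsUrysohn isUrysohn using (countable)

  Pinches : Carrier → U → (U → U) → (U → U) → Set
  Pinches ε a φ ψ = IsIsometricEmbedding R m m φ × IsIsometricEmbedding R m m ψ ×
                    (∀ b → ¬ Ball R m ε a b → φ b ≡ ψ b) ×
                    (∀ b → Ball R m ε a b → φ b ≢ ψ b)

  pinching-pair : ∀ ε a → Σ (U → U) λ φ → Σ (U → U) λ ψ → Pinches ε a φ ψ
  pinching-pair ε a =
    copies-pinch (embed-countable ((countable ×-↠ ↠-id Bool) ↠-∘ ℕ↠ℕ×Bool) doubled doubled-isPseudometric)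
    where
    depth : U → Carrier
    depth x = ε ∸ d a x
    depth-lipschitz : IsLipschitz m depth
    depth-lipschitz x y = ∸-lipschitzʳ (d-tri a x y)
    open Doubling R m depth depth-lipschitz
    copies-pinch : Σ (U × Bool → U) (Isometric doubled) → Σ (U → U) λ φ → Σ (U → U) λ ψ → Pinches ε a φ ψ
    copies-pinch (e , e-isometric) = φ , ψ , (λ x y → e-isometric (x , false) (y , false))
                                           , (λ x y → e-isometric (x , true) (y , true)) , agree , differ
      where
      φ ψ : U → U
      φ x = e (x , false)
      ψ x = e (x , true)
      d-φ-ψ : ∀ b → d (φ b) (ψ b) ≡ depth b
      d-φ-ψ b = trans (e-isometric (b , false) (b , true)) (cross-diagonal b)
      agree : ∀ b → ¬ Ball R m ε a b → φ b ≡ ψ b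
      agree b b∉B = d-zero⇒≡ _ _ (trans (d-φ-ψ b) (r≤s⇒r∸s≡0 (≮⇒≥ _≤?_ b∉B)))
      differ : ∀ b → Ball R m ε a b → φ b ≢ ψ b
      differ b b∈B φb≡ψb = s<r⇒r∸s≢0 b∈B (trans (sym (d-φ-ψ b)) (≡⇒d≡0 φb≡ψb))

lemma7p21 : (R : DistanceMonoid) →
    MetricallyComplete R → Standard R → CountablyInfinite R →
    Decidable (DistanceMonoid._≤_ R) →
    (U : Set) (m : Metric R U) → IsUrysohn R U m →
    Σ (DistanceMonoid.Carrier R) λ ε₀ → ε₀ ≢ DistanceMonoid.0# R ×
      (∀ ε → ε ≢ DistanceMonoid.0# R → DistanceMonoid._≤_ R ε ε₀ →
        ∀ (a : U) → Σ (U → U) λ φ → Σ (U → U) λ ψ →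
          IsIsometricEmbedding R m m φ × IsIsometricEmbedding R m m ψ ×
          (∀ b → ¬ Ball R m ε a b → φ b ≡ ψ b) ×
          (∀ b → Ball R m ε a b → φ b ≢ ψ b))
lemma7p21 R metricallyComplete _ countablyInfinite _≤?_ U m isUrysohn
  with DistanceMonoidProperties.nonzero-element R _≤?_ countablyInfinite
... | ε₀ , ε₀≢0 =
  ε₀ , ε₀≢0 , λ ε _ _ → Pinching.pinching-pair R metricallyComplete _≤?_ m isUrysohn ε
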